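{- Let $\alpha\le 4$ be a positive integer and $k>2$ an integer. If a digraph $D$ admits a quasi-$(\alpha,k-1)$-labeling, then for every positive integer $m$ the $m$-th line digraph $L^m(D)$ is a DNA graph.
   Context: All digraphs are finite. For an arc $a=uv$ of a digraph, $u$ is its tail and $v$ its head. The line digraph $L(D)$ of a digraph $D$ has vertex set $A(D)$, and there is an arc $xy$ in $L(D)$ iff the head of $x$ equals the tail of $y$ in $D$. Set $L^1(D)=L(D)$ and $L^{m+1}(D)=L(L^m(D))$. For integers $\alpha>0$ and $k>1$, an $(\alpha,k)$-labeling of a digraph $D=(V,A)$ assigns to each vertex $x$ a string $(l_1(x),\dots,l_k(x))$ with all $l_i(x)\in\{1,\dots,\alpha\}$ such that distinct vertices receive distinct strings and, for all vertices $x,y$: $xy\in A$ if and only if $l_i(x)=l_{i-1}(y)$ for all $i\in\{2,\dots,k\}$. A quasi-$(\alpha,k)$-labeling satisfies the same conditions except that only the implication $xy\in A\Rightarrow l_i(x)=l_{i-1}(y)$ for all $i\in\{2,\dots,k\}$ is required. A DNA graph is a digraph admitting a $(4,k)$-labeling for some integer $k>1$. -}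

module Defs where

open import Data.Nat using (ℕ; zero; suc; _<_; _≤_)
open import Data.Fin using (Fin; toℕ)
open import Data.Bool using (Bool; true; false; T)
open import Data.Unit using (tt)
open import Data.Product using (Σ; _×_; _,_; proj₁; proj₂; ∃-syntax)
open import Relation.Binary.PropositionalEquality using (_≡_; refl)
open import Relation.Binary.Definitions using (DecidableEquality)
open import Relation.Nullary using (yes; no; ¬_)
open import Relation.Nullary.Decidable using (⌊_⌋)
open import Function.Bundles using (_⇔_)

-- A digraph: a vertex type with decidable equality and a Bool-valued arc
-- relation (so at most one arc from u to v; loops allowed).
record Digraph : Set₁ where
  field
    V    : Set
    _≟V_ : DecidableEquality V
    arc  : V → V → Bool
open Digraph public

Arc : Digraph → Set
Arc D = Σ (V D × V D) (λ p → T (arc D (proj₁ p) (proj₂ p)))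

tail head : (D : Digraph) → Arc D → V D
tail D a = proj₁ (proj₁ a)
head D a = proj₂ (proj₁ a)

private
  T-irr : ∀ {b} (p q : T b) → p ≡ q
  T-irr {true} tt tt = refl

_≟Arc_ : {D : Digraph} → DecidableEquality (Arc D)
_≟Arc_ {D} ((u , v) , p) ((u' , v') , p') with _≟V_ D u u' | _≟V_ D v v'
... | yes refl | yes refl with T-irr p p'
...   | refl = yes refl
_≟Arc_ {D} ((u , v) , p) ((u' , v') , p') | no ne | _ = no λ { refl → ne refl }
_≟Arc_ {D} ((u , v) , p) ((u' , v') , p') | yes _ | no ne = no λ { refl → ne refl }

L : Digraph → Digraph
L D = record
  { V    = Arc D
  ; _≟V_ = _≟Arc_ {D}
  ; arc  = λ x y → ⌊ _≟V_ D (head D x) (tail D y) ⌋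
  }

L^ : ℕ → Digraph → Digraph
L^ zero    D = D
L^ (suc m) D = L (L^ m D)

-- A labeling candidate: each vertex gets a string of length k over an
-- alphabet of α symbols (Fin α stands for {1,…,α}); position i ∈ Fin k
-- stands for index toℕ i + 1.
Labels : Digraph → ℕ → ℕ → Set
Labels D α k = V D → Fin k → Fin α

DistinctStrings : (D : Digraph) {α k : ℕ} → Labels D α k → Set
DistinctStrings D l = ∀ x y → (∀ i → l x i ≡ l y i) → x ≡ y

Overlap : (D : Digraph) {α k : ℕ} → Labels D α k → V D → V D → Set
Overlap D {k = k} l x y = ∀ (i j : Fin k) → toℕ i ≡ suc (toℕ j) → l x i ≡ l y j

IsLabeling : (D : Digraph) (α k : ℕ) → Labels D α k → Set
IsLabeling D α k l =
  (0 < α) × (1 < k) × DistinctStrings D l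
  × (∀ x y → T (arc D x y) ⇔ Overlap D l x y)

IsQuasiLabeling : (D : Digraph) (α k : ℕ) → Labels D α k → Set
IsQuasiLabeling D α k l =
  (0 < α) × (1 < k) × DistinctStrings D l
  × (∀ x y → T (arc D x y) → Overlap D l x y)

HasLabeling HasQuasiLabeling : Digraph → ℕ → ℕ → Set
HasLabeling D α k = Σ (Labels D α k) (IsLabeling D α k)
HasQuasiLabeling D α k = Σ (Labels D α k) (IsQuasiLabeling D α k)

IsDNAGraph : Digraph → Set
IsDNAGraph D = ∃[ k ] (1 < k × HasLabeling D 4 k)

module Submission where

-- If l is a quasi-(α,k)-labeling of D, label each arc uv of D by
-- the first symbol of l(u) followed by the whole string l(v).  Since uv is an
-- arc, l(u) and l(v) overlap, so the string of uv with its last symbol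
-- dropped is exactly l(u); hence the string of an arc determines both of its
-- endpoints (distinctness), and two arc strings overlap iff
-- l(head x) = l(tail y) iff head x = tail y, i.e. iff xy is an arc of L(D).
-- This gives an (α,k+1)-labeling of L(D) (lineLabeling).  A labeling is in
-- particular a quasi-labeling, so the construction iterates to L^m(D)
-- (iteratedLineLabeling), and a labeling over α ≤ 4 symbols is a labeling
-- over 4 symbols (enlargeAlphabet), which is the definition of a DNA graph.

open import Defs
open import Data.Nat using (ℕ; _<_; _≤_; _∸_; _+_; pred; zero; suc; s≤s; z≤n)
open import Data.Nat.Properties using (<-≤-trans)
open import Data.Fin using (Fin; zero; suc; toℕ; inject₁; inject≤)
open import Data.Fin.Properties using (toℕ-inject₁; toℕ-injective; inject≤-injective)
open import Data.Bool using (T)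
open import Data.Bool.Properties using (T-irrelevant)
open import Data.Product using (_,_)
open import Relation.Binary.PropositionalEquality using (_≡_; refl; sym; trans; cong)
open import Relation.Nullary.Decidable using (toWitness; fromWitness)
open import Function.Bundles using (_⇔_; mk⇔; Equivalence)

arc-≡ : (D : Digraph) {a b : Arc D} → tail D a ≡ tail D b → head D a ≡ head D b → a ≡ b
arc-≡ D {(u , v) , p} {(.u , .v) , q} refl refl = cong (λ r → (u , v) , r) (T-irrelevant p q)

Shifted : (D : Digraph) {α n : ℕ} → Labels D α (suc n) → V D → V D → Set
Shifted D {n = n} l x y = ∀ (j : Fin n) → l x (suc j) ≡ l y (inject₁ j)

-- Overlap and Shifted agree: the index pairs (i , j) with toℕ i = toℕ j + 1
-- are exactly the pairs (suc j' , inject₁ j').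
overlap⇔shifted : (D : Digraph) {α n : ℕ} (l : Labels D α (suc n)) (x y : V D)
                → Overlap D l x y ⇔ Shifted D l x y
overlap⇔shifted D l x y = mk⇔ toShifted fromShifted
  where
    toShifted : Overlap D l x y → Shifted D l x y
    toShifted o j = o (suc j) (inject₁ j) (cong suc (sym (toℕ-inject₁ j)))

    fromShifted : Shifted D l x y → Overlap D l x y
    fromShifted s (suc i) j i≡j+1 =
      trans (s i) (cong (l y) (toℕ-injective (trans (toℕ-inject₁ i) (cong pred i≡j+1))))

labeling⇒quasi : (D : Digraph) {α k : ℕ} → HasLabeling D α k → HasQuasiLabeling D α k
labeling⇒quasi D (l , α>0 , k>1 , distinct , arc⇔overlap) =
  l , α>0 , k>1 , distinct , λ x y → Equivalence.to (arc⇔overlap x y)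

module LineLabeling (D : Digraph) {α n : ℕ} (l : Labels D α (suc n))
                    (distinct : DistinctStrings D l)
                    (arc⇒overlap : ∀ x y → T (arc D x y) → Overlap D l x y) where

  arcLabel : Labels (L D) α (suc (suc n))
  arcLabel a zero    = l (tail D a) zero
  arcLabel a (suc j) = l (head D a) j

  -- Dropping the last symbol of the string of uv gives l(u): this is where
  -- the quasi-labeling property of the arc uv is used.
  arcLabel-init : ∀ a (j : Fin (suc n)) → arcLabel a (inject₁ j) ≡ l (tail D a) j
  arcLabel-init a zero    = refl
  arcLabel-init ((u , v) , uv) (suc j) =
    sym (Equivalence.to (overlap⇔shifted D l u v) (arc⇒overlap u v uv) j)

  arcLabel-distinct : DistinctStrings (L D) arcLabel
  arcLabel-distinct a b same = arc-≡ D sameTail sameHead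
    where
      sameTail : tail D a ≡ tail D b
      sameTail = distinct _ _ λ j →
        trans (sym (arcLabel-init a j)) (trans (same (inject₁ j)) (arcLabel-init b j))
      sameHead : head D a ≡ head D b
      sameHead = distinct _ _ λ j → same (suc j)

  -- Overlap of arc strings means l(head a) = l(tail b), i.e. head a = tail b.
  arcLabel-arc⇔overlap : ∀ a b → T (arc (L D) a b) ⇔ Overlap (L D) arcLabel a b
  arcLabel-arc⇔overlap a b = mk⇔ arc⇒ ⇒arc
    where
      shifted⇔ : Overlap (L D) arcLabel a b ⇔ Shifted (L D) arcLabel a b
      shifted⇔ = overlap⇔shifted (L D) arcLabel a b

      arc⇒ : T (arc (L D) a b) → Overlap (L D) arcLabel a b
      arc⇒ ab = Equivalence.from shifted⇔ λ j →
        trans (cong (λ w → l w j) (toWitness ab)) (sym (arcLabel-init b j))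

      ⇒arc : Overlap (L D) arcLabel a b → T (arc (L D) a b)
      ⇒arc o = fromWitness (distinct _ _ λ j →
        trans (Equivalence.to shifted⇔ o j) (arcLabel-init b j))

lineLabeling : (D : Digraph) {α n : ℕ}
             → HasQuasiLabeling D α (suc n) → HasLabeling (L D) α (suc (suc n))
lineLabeling D (l , α>0 , _ , distinct , arc⇒overlap) =
  arcLabel , α>0 , s≤s (s≤s z≤n) , arcLabel-distinct , arcLabel-arc⇔overlap
  where open LineLabeling D l distinct arc⇒overlap

iteratedLineLabeling : (D : Digraph) {α n : ℕ} → HasQuasiLabeling D α (suc n)
                     → (m : ℕ) → HasLabeling (L^ (suc m) D) α (suc (suc (m + n)))
iteratedLineLabeling D q zero    = lineLabeling D q
iteratedLineLabeling D q (suc m) =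
  lineLabeling (L^ (suc m) D) (labeling⇒quasi (L^ (suc m) D) (iteratedLineLabeling D q m))

enlargeAlphabet : (D : Digraph) {α β k : ℕ} → α ≤ β → HasLabeling D α k → HasLabeling D β k
enlargeAlphabet D {α} {β} {k} α≤β (l , α>0 , k>1 , distinct , arc⇔overlap) =
  embedded , <-≤-trans α>0 α≤β , k>1 , embedded-distinct , λ x y → mk⇔
    (λ xy i j i≡j+1 → cong embed (Equivalence.to (arc⇔overlap x y) xy i j i≡j+1))
    (λ o → Equivalence.from (arc⇔overlap x y) λ i j i≡j+1 → embed-injective (o i j i≡j+1))
  where
    embed : Fin α → Fin β
    embed i = inject≤ i α≤β

    embed-injective : ∀ {i j} → embed i ≡ embed j → i ≡ j
    embed-injective = inject≤-injective α≤β α≤β _ _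

    embedded : Labels D β k
    embedded x i = embed (l x i)

    embedded-distinct : DistinctStrings D embedded
    embedded-distinct x y same = distinct x y λ i → embed-injective (same i)

corollary1 : (α k : ℕ) → 0 < α → α ≤ 4 → 2 < k → (D : Digraph) → HasQuasiLabeling D α (k ∸ 1) → (m : ℕ) → 0 < m → IsDNAGraph (L^ m D)
corollary1 α (suc (suc (suc k))) _ α≤4 (s≤s (s≤s (s≤s _))) D quasi (suc m) (s≤s _) =
  suc (suc (m + suc k)) , s≤s (s≤s z≤n) ,
  enlargeAlphabet (L^ (suc m) D) α≤4 (iteratedLineLabeling D quasi m)
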